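{- Let $\phi$ be a formula and $\alpha$ a valuation. (i) If the computation tree $[\![\phi]\!]_\alpha$ contains a success leaf labelled with a valuation $\alpha'$, then $\alpha'$ extends $\alpha$ and the universal closure $\forall(\phi^{\alpha'})$ is true in $I$ (in particular the existential closure $\exists(\phi^{\alpha})$ is true in $I$). (ii) If $[\![\phi]\!]_\alpha$ is failed, then $\exists(\phi^{\alpha})$ is false in $I$.
   Context: Fix a first-order language with equality and an interpretation $I$ of it with domain $D$. A valuation is a finite single-valued set of pairs $x/d$ ($x$ a variable, $d\in D$); $\alpha'$ extends $\alpha$ if $\alpha\subseteq\alpha'$. A term $t$ is $\alpha$-closed if all its variables get a value in $\alpha$, and then $t^\alpha\in D$ is its value under $\alpha$; for an expression $E$, $E^\alpha$ is the result of replacing each $\alpha$-closed term $t$ in $E$ by (a name of) $t^\alpha$. A formula is $\alpha$-closed if all its free variables get a value in $\alpha$. An $\alpha$-assignment is an equation $s=t$ one side of which is a variable not assigned by $\alpha$ and the other side an $\alpha$-closed term. $\forall(\chi)$ and $\exists(\chi)$ denote the universal and existential closures of $\chi$. Formulas (no universal quantifier; conjunctions right-associative) are generated by: the empty conjunction $\Box$; $A\wedge\psi$ with $A$ an atom; $(\phi_1\vee\phi_2)\wedge\psi$; $(\phi_1\wedge\phi_2)\wedge\psi$; $(\phi_1\to\phi_2)\wedge\psi$; $\neg\phi\wedge\psi$; $\exists x\,\phi\wedge\psi$, where $\psi,\phi,\phi_1,\phi_2$ are formulas. The computation tree $[\![\phi]\!]_\alpha$ is a finite tree whose root is labelled $(\phi,\alpha)$,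 whose internal nodes are labelled by (formula, valuation) pairs, and whose leaves are labelled $\mathit{error}$, $\mathit{fail}$, or a valuation (a success leaf). It is defined by induction (lexicographically on the size of the formula and the size of its first conjunct): 1. $[\![\Box]\!]_\alpha$: the root has a single child, the success leaf $\alpha$. 2. $[\![A\wedge\psi]\!]_\alpha$, $A$ an atom: if $A$ is $\alpha$-closed and true in $I$ (under $\alpha$), the root's unique subtree is $[\![\psi]\!]_\alpha$; if $A$ is $\alpha$-closed and false, the root's unique child is $\mathit{fail}$; if $A$ is not $\alpha$-closed and not an $\alpha$-assignment, the unique child is $\mathit{error}$; if $A$ is an $\alpha$-assignment $x=t$ or $t=x$ with $x$ not assigned by $\alpha$ and $t$ $\alpha$-closed, the unique subtree is $[\![\psi]\!]_{\alpha\cup\{x/t^\alpha\}}$. 3. $[\![(\phi_1\vee\phi_2)\wedge\psi]\!]_\alpha$: root with two subtrees $[\![\phi_1\wedge\psi]\!]_\alpha$ and $[\![\phi_2\wedge\psi]\!]_\alpha$. 4. $[\![(\phi_1\wedge\phi_2)\wedge\psi]\!]_\alpha$: root with unique subtree $[\![\phi_1\wedge(\phi_2\wedge\psi)]\!]_\alpha$. 5. $[\![(\phi_1\to\phi_2)\wedge\psi]\!]_\alpha$: if $\phi_1$ is $\alpha$-closed and $[\![\phi_1]\!]_\alpha$ has only $\mathit{fail}$ leaves, unique subtree $[\![\psi]\!]_\alpha$; if $\phi_1$ is $\alpha$-closed and $[\![\phi_1]\!]_\alpha$ contains a success leaf, unique subtree $[\![\phi_2\wedge\psi]\!]_\alpha$;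 otherwise unique child $\mathit{error}$. 6. $[\![\neg\phi\wedge\psi]\!]_\alpha$: if $\phi$ is $\alpha$-closed and $[\![\phi]\!]_\alpha$ has only $\mathit{fail}$ leaves, unique subtree $[\![\psi]\!]_\alpha$; if $\phi$ is $\alpha$-closed and $[\![\phi]\!]_\alpha$ contains a success leaf, unique child $\mathit{fail}$; otherwise unique child $\mathit{error}$. 7. $[\![\exists x\,\phi\wedge\psi]\!]_\alpha$, where the bound variable $x$ is (after renaming) fresh, i.e. not in the domain of $\alpha$ and not occurring in $\psi$: unique subtree $[\![\phi\wedge\psi]\!]_\alpha$. A computation tree is failed if it contains only $\mathit{fail}$ leaves. -}

module Defs where

open import Data.Nat using (ℕ; _≟_)
open import Data.Vec using (Vec; []; _∷_)
open import Data.Vec.Relation.Unary.Any as VAny using ()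
open import Data.List using (List; []; _∷_; _++_; filter)
open import Data.List.Membership.Propositional using (_∈_)
open import Data.List.Relation.Unary.All using (All)
open import Data.List.Relation.Unary.Any as LAny using ()
open import Data.Maybe using (Maybe; just; nothing; _>>=_)
open import Data.Product using (Σ; _×_; _,_; proj₁)
open import Data.Sum using (_⊎_)
open import Data.Empty using (⊥)
open import Data.Unit using (⊤)
open import Relation.Nullary using (¬_; yes; no; ¬?)
open import Relation.Binary.PropositionalEquality using (_≡_; _≢_)

Var : Set
Var = ℕ

record Signature : Set₁ where
  field
    Fun      : Set
    Rel      : Set
    funArity : Fun → ℕ
    relArity : Rel → ℕ

record Interpretation (S : Signature) : Set₁ where
  open Signature S
  field
    D          : Set
    inhabitant : D
    funI       : (f : Fun) → Vec D (funArity f) → D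
    relI       : (R : Rel) → Vec D (relArity R) → Set

-- Syntax.  Terms are parametrised by a set N of "names" (constants for
-- domain elements).  Program formulas use N = ⊥ (no names); the
-- instantiated formulas φ^α use N = D.

module Syntax (S : Signature) where
  open Signature S

  data Term (N : Set) : Set where
    var : Var → Term N
    nm  : N → Term N
    fun : (f : Fun) → Vec (Term N) (funArity f) → Term N

  data Atom (N : Set) : Set where
    _≐_ : Term N → Term N → Atom N
    rel : (R : Rel) → Vec (Term N) (relArity R) → Atom N

  -- A formula is a right-associated conjunction  c₁ ∧ (c₂ ∧ … ∧ □)
  -- represented as the list of its conjuncts (□ = []).
  -- For formulas φ, ψ the conjunction φ ∧ ψ (right-associated) is φ ++ ψ.
  data Conj (N : Set) : Set where
    atom : Atom N → Conj N
    or   : List (Conj N) → List (Conj N) → Conj N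
    and  : List (Conj N) → List (Conj N) → Conj N
    imp  : List (Conj N) → List (Conj N) → Conj N
    neg  : List (Conj N) → Conj N
    ex   : Var → List (Conj N) → Conj N

  Formula : Set → Set
  Formula N = List (Conj N)

  data OccT {N : Set} (x : Var) : Term N → Set where
    here  : OccT x (var x)
    inFun : ∀ {f ts} → VAny.Any (OccT x) ts → OccT x (fun f ts)

  data OccA {N : Set} (x : Var) : Atom N → Set where
    inEq₁ : ∀ {s t} → OccT x s → OccA x (s ≐ t)
    inEq₂ : ∀ {s t} → OccT x t → OccA x (s ≐ t)
    inRel : ∀ {R ts} → VAny.Any (OccT x) ts → OccA x (rel R ts)

  data FreeC {N : Set} (x : Var) : Conj N → Set where
    fAtom : ∀ {A} → OccA x A → FreeC x (atom A)
    fOr₁  : ∀ {φ₁ φ₂} → LAny.Any (FreeC x) φ₁ → FreeC x (or φ₁ φ₂)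
    fOr₂  : ∀ {φ₁ φ₂} → LAny.Any (FreeC x) φ₂ → FreeC x (or φ₁ φ₂)
    fAnd₁ : ∀ {φ₁ φ₂} → LAny.Any (FreeC x) φ₁ → FreeC x (and φ₁ φ₂)
    fAnd₂ : ∀ {φ₁ φ₂} → LAny.Any (FreeC x) φ₂ → FreeC x (and φ₁ φ₂)
    fImp₁ : ∀ {φ₁ φ₂} → LAny.Any (FreeC x) φ₁ → FreeC x (imp φ₁ φ₂)
    fImp₂ : ∀ {φ₁ φ₂} → LAny.Any (FreeC x) φ₂ → FreeC x (imp φ₁ φ₂)
    fNeg  : ∀ {φ} → LAny.Any (FreeC x) φ → FreeC x (neg φ)
    fEx   : ∀ {y φ} → x ≢ y → LAny.Any (FreeC x) φ → FreeC x (ex y φ)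

  FreeF : {N : Set} → Var → Formula N → Set
  FreeF x φ = LAny.Any (FreeC x) φ

  data OccC {N : Set} (x : Var) : Conj N → Set where
    oAtom : ∀ {A} → OccA x A → OccC x (atom A)
    oOr₁  : ∀ {φ₁ φ₂} → LAny.Any (OccC x) φ₁ → OccC x (or φ₁ φ₂)
    oOr₂  : ∀ {φ₁ φ₂} → LAny.Any (OccC x) φ₂ → OccC x (or φ₁ φ₂)
    oAnd₁ : ∀ {φ₁ φ₂} → LAny.Any (OccC x) φ₁ → OccC x (and φ₁ φ₂)
    oAnd₂ : ∀ {φ₁ φ₂} → LAny.Any (OccC x) φ₂ → OccC x (and φ₁ φ₂)
    oImp₁ : ∀ {φ₁ φ₂} → LAny.Any (OccC x) φ₁ → OccC x (imp φ₁ φ₂)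
    oImp₂ : ∀ {φ₁ φ₂} → LAny.Any (OccC x) φ₂ → OccC x (imp φ₁ φ₂)
    oNeg  : ∀ {φ} → LAny.Any (OccC x) φ → OccC x (neg φ)
    oBind : ∀ {φ} → OccC x (ex x φ)
    oEx   : ∀ {y φ} → LAny.Any (OccC x) φ → OccC x (ex y φ)

  OccF : {N : Set} → Var → Formula N → Set
  OccF x φ = LAny.Any (OccC x) φ

  renV : Var → Var → Var → Var
  renV x y z with z ≟ x
  ... | yes _ = y
  ... | no  _ = z

  mutual
    renT : {N : Set} → Var → Var → Term N → Term N
    renT x y (var z)    = var (renV x y z)
    renT x y (nm n)     = nm n
    renT x y (fun f ts) = fun f (renTs x y ts)

    renTs : {N : Set} {n : ℕ} → Var → Var → Vec (Term N) n → Vec (Term N) n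
    renTs x y []       = []
    renTs x y (t ∷ ts) = renT x y t ∷ renTs x y ts

  renA : {N : Set} → Var → Var → Atom N → Atom N
  renA x y (s ≐ t)    = renT x y s ≐ renT x y t
  renA x y (rel R ts) = rel R (renTs x y ts)

  mutual
    renC : {N : Set} → Var → Var → Conj N → Conj N
    renC x y (atom A)    = atom (renA x y A)
    renC x y (or φ₁ φ₂)  = or (renF x y φ₁) (renF x y φ₂)
    renC x y (and φ₁ φ₂) = and (renF x y φ₁) (renF x y φ₂)
    renC x y (imp φ₁ φ₂) = imp (renF x y φ₁) (renF x y φ₂)
    renC x y (neg φ)     = neg (renF x y φ)
    renC x y (ex z φ) with z ≟ x
    ... | yes _ = ex z φ
    ... | no  _ = ex z (renF x y φ)

    renF : {N : Set} → Var → Var → Formula N → Formula N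
    renF x y []      = []
    renF x y (c ∷ φ) = renC x y c ∷ renF x y φ

module Semantics (S : Signature) (I : Interpretation S) where
  open Signature S
  open Interpretation I
  open Syntax S public

  -- valuations: finite sets of pairs x/d, represented as lists
  Valuation : Set
  Valuation = List (Var × D)

  SingleValued : Valuation → Set
  SingleValued α = ∀ {x d e} → (x , d) ∈ α → (x , e) ∈ α → d ≡ e

  _extends_ : Valuation → Valuation → Set
  α' extends α = ∀ {p} → p ∈ α → p ∈ α'

  _∈dom_ : Var → Valuation → Set
  x ∈dom α = Σ D λ d → (x , d) ∈ α

  lookupV : Valuation → Var → Maybe D
  lookupV []            x = nothing
  lookupV ((y , d) ∷ α) x with x ≟ y
  ... | yes _ = just d
  ... | no  _ = lookupV α x

  -- value t^α of a (name-free) term; nothing iff t is not α-closed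
  mutual
    evalT : Valuation → Term ⊥ → Maybe D
    evalT α (var x)    = lookupV α x
    evalT α (nm ())
    evalT α (fun f ts) = evalTs α ts >>= λ ds → just (funI f ds)

    evalTs : {n : ℕ} → Valuation → Vec (Term ⊥) n → Maybe (Vec D n)
    evalTs α []       = just []
    evalTs α (t ∷ ts) = evalT α t >>= λ d → evalTs α ts >>= λ ds → just (d ∷ ds)

  ClosedT : Valuation → Term ⊥ → Set
  ClosedT α t = ∀ x → OccT x t → x ∈dom α

  ClosedA : Valuation → Atom ⊥ → Set
  ClosedA α A = ∀ x → OccA x A → x ∈dom α

  ClosedF : Valuation → Formula ⊥ → Set
  ClosedF α φ = ∀ x → FreeF x φ → x ∈dom α

  -- truth in I of the atom A under α (meaningful for α-closed A)
  HoldsA : Valuation → Atom ⊥ → Set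
  HoldsA α (s ≐ t)    = Σ D λ d → evalT α s ≡ just d × evalT α t ≡ just d
  HoldsA α (rel R ts) = Σ (Vec D (relArity R)) λ ds → evalTs α ts ≡ just ds × relI R ds

  data Assignment (α : Valuation) : Atom ⊥ → Var → D → Set where
    asgL : ∀ {x t d} → ¬ (x ∈dom α) → ClosedT α t → evalT α t ≡ just d →
           Assignment α (var x ≐ t) x d
    asgR : ∀ {x t d} → ¬ (x ∈dom α) → ClosedT α t → evalT α t ≡ just d →
           Assignment α (t ≐ var x) x d

  IsAssignment : Valuation → Atom ⊥ → Set
  IsAssignment α A = Σ Var λ x → Σ D λ d → Assignment α A x d

  data Tree : Set where
    errorLeaf : Tree
    failLeaf  : Tree
    succLeaf  : Valuation → Tree
    node      : Formula ⊥ → Valuation → List Tree → Tree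

  data SuccessLeaf (α' : Valuation) : Tree → Set where
    leaf  : SuccessLeaf α' (succLeaf α')
    below : ∀ {φ β ts} → LAny.Any (SuccessLeaf α') ts → SuccessLeaf α' (node φ β ts)

  HasSuccess : Tree → Set
  HasSuccess T = Σ Valuation λ α' → SuccessLeaf α' T

  data Failed : Tree → Set where
    leaf : Failed failLeaf
    node : ∀ {φ β ts} → All Failed ts → Failed (node φ β ts)

  -- Comp φ α T :  T is the computation tree ⟦φ⟧_α
  data Comp : Formula ⊥ → Valuation → Tree → Set where
    c-□      : ∀ {α} → Comp [] α (node [] α (succLeaf α ∷ []))
    c-true   : ∀ {A ψ α T} → ClosedA α A → HoldsA α A → Comp ψ α T →
               Comp (atom A ∷ ψ) α (node (atom A ∷ ψ) α (T ∷ []))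
    c-false  : ∀ {A ψ α} → ClosedA α A → ¬ HoldsA α A →
               Comp (atom A ∷ ψ) α (node (atom A ∷ ψ) α (failLeaf ∷ []))
    c-aerr   : ∀ {A ψ α} → ¬ ClosedA α A → ¬ IsAssignment α A →
               Comp (atom A ∷ ψ) α (node (atom A ∷ ψ) α (errorLeaf ∷ []))
    c-assign : ∀ {A ψ α x d T} → Assignment α A x d → Comp ψ ((x , d) ∷ α) T →
               Comp (atom A ∷ ψ) α (node (atom A ∷ ψ) α (T ∷ []))
    c-or     : ∀ {φ₁ φ₂ ψ α T₁ T₂} → Comp (φ₁ ++ ψ) α T₁ → Comp (φ₂ ++ ψ) α T₂ →
               Comp (or φ₁ φ₂ ∷ ψ) α (node (or φ₁ φ₂ ∷ ψ) α (T₁ ∷ T₂ ∷ []))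
    c-and    : ∀ {φ₁ φ₂ ψ α T} → Comp (φ₁ ++ (φ₂ ++ ψ)) α T →
               Comp (and φ₁ φ₂ ∷ ψ) α (node (and φ₁ φ₂ ∷ ψ) α (T ∷ []))
    c-impF   : ∀ {φ₁ φ₂ ψ α T₁ T} → ClosedF α φ₁ → Comp φ₁ α T₁ → Failed T₁ →
               Comp ψ α T →
               Comp (imp φ₁ φ₂ ∷ ψ) α (node (imp φ₁ φ₂ ∷ ψ) α (T ∷ []))
    c-impS   : ∀ {φ₁ φ₂ ψ α T₁ T} → ClosedF α φ₁ → Comp φ₁ α T₁ → HasSuccess T₁ →
               Comp (φ₂ ++ ψ) α T →
               Comp (imp φ₁ φ₂ ∷ ψ) α (node (imp φ₁ φ₂ ∷ ψ) α (T ∷ []))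
    c-impE   : ∀ {φ₁ φ₂ ψ α} →
               (¬ ClosedF α φ₁ ⊎ Σ Tree λ T₁ → Comp φ₁ α T₁ × ¬ Failed T₁ × ¬ HasSuccess T₁) →
               Comp (imp φ₁ φ₂ ∷ ψ) α (node (imp φ₁ φ₂ ∷ ψ) α (errorLeaf ∷ []))
    c-negF   : ∀ {φ ψ α T₁ T} → ClosedF α φ → Comp φ α T₁ → Failed T₁ →
               Comp ψ α T →
               Comp (neg φ ∷ ψ) α (node (neg φ ∷ ψ) α (T ∷ []))
    c-negS   : ∀ {φ ψ α T₁} → ClosedF α φ → Comp φ α T₁ → HasSuccess T₁ →
               Comp (neg φ ∷ ψ) α (node (neg φ ∷ ψ) α (failLeaf ∷ []))
    c-negE   : ∀ {φ ψ α} →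
               (¬ ClosedF α φ ⊎ Σ Tree λ T₁ → Comp φ α T₁ × ¬ Failed T₁ × ¬ HasSuccess T₁) →
               Comp (neg φ ∷ ψ) α (node (neg φ ∷ ψ) α (errorLeaf ∷ []))
    -- ∃x φ ∧ ψ : the bound variable is first renamed to a fresh y
    -- (y = x allowed when x is already fresh)
    c-ex     : ∀ {x φ ψ α T} (y : Var) → ¬ (y ∈dom α) → ¬ FreeF y ψ →
               (y ≡ x ⊎ ¬ OccF y φ) →
               Comp (renF x y φ ++ ψ) α T →
               Comp (ex x φ ∷ ψ) α (node (ex x φ ∷ ψ) α (T ∷ []))

  -- E^α : replace every α-closed term t by (a name of) t^α

  removeV : Var → Valuation → Valuation
  removeV x = filter (λ p → ¬? (proj₁ p ≟ x))

  mutual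
    substT : Valuation → Term ⊥ → Term D
    substT α (var x) with lookupV α x
    ... | just d  = nm d
    ... | nothing = var x
    substT α (nm ())
    substT α (fun f ts) with evalTs α ts
    ... | just ds = nm (funI f ds)
    ... | nothing = fun f (substTs α ts)

    substTs : {n : ℕ} → Valuation → Vec (Term ⊥) n → Vec (Term D) n
    substTs α []       = []
    substTs α (t ∷ ts) = substT α t ∷ substTs α ts

  substA : Valuation → Atom ⊥ → Atom D
  substA α (s ≐ t)    = substT α s ≐ substT α t
  substA α (rel R ts) = rel R (substTs α ts)

  mutual
    substC : Valuation → Conj ⊥ → Conj D
    substC α (atom A)    = atom (substA α A)
    substC α (or φ₁ φ₂)  = or (substF α φ₁) (substF α φ₂)
    substC α (and φ₁ φ₂) = and (substF α φ₁) (substF α φ₂)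
    substC α (imp φ₁ φ₂) = imp (substF α φ₁) (substF α φ₂)
    substC α (neg φ)     = neg (substF α φ)
    substC α (ex x φ)    = ex x (substF (removeV x α) φ)

    substF : Valuation → Formula ⊥ → Formula D
    substF α []      = []
    substF α (c ∷ φ) = substC α c ∷ substF α φ

  Env : Set
  Env = Var → D

  _[_↦_] : Env → Var → D → Env
  (ρ [ x ↦ d ]) z with z ≟ x
  ... | yes _ = d
  ... | no  _ = ρ z

  mutual
    ⟦_⟧T : Term D → Env → D
    ⟦ var x ⟧T    ρ = ρ x
    ⟦ nm d ⟧T     ρ = d
    ⟦ fun f ts ⟧T ρ = funI f (⟦ ts ⟧Ts ρ)

    ⟦_⟧Ts : {n : ℕ} → Vec (Term D) n → Env → Vec D n
    ⟦ [] ⟧Ts     ρ = []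
    ⟦ t ∷ ts ⟧Ts ρ = ⟦ t ⟧T ρ ∷ ⟦ ts ⟧Ts ρ

  SatA : Env → Atom D → Set
  SatA ρ (s ≐ t)    = ⟦ s ⟧T ρ ≡ ⟦ t ⟧T ρ
  SatA ρ (rel R ts) = relI R (⟦ ts ⟧Ts ρ)

  mutual
    SatC : Env → Conj D → Set
    SatC ρ (atom A)    = SatA ρ A
    SatC ρ (or φ₁ φ₂)  = SatF ρ φ₁ ⊎ SatF ρ φ₂
    SatC ρ (and φ₁ φ₂) = SatF ρ φ₁ × SatF ρ φ₂
    SatC ρ (imp φ₁ φ₂) = SatF ρ φ₁ → SatF ρ φ₂
    SatC ρ (neg φ)     = ¬ SatF ρ φ
    SatC ρ (ex x φ)    = Σ D λ d → SatF (ρ [ x ↦ d ]) φ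

    SatF : Env → Formula D → Set
    SatF ρ []      = ⊤
    SatF ρ (c ∷ φ) = SatC ρ c × SatF ρ φ

  UnivClosureTrue : Formula D → Set
  UnivClosureTrue χ = ∀ (ρ : Env) → SatF ρ χ

  ExClosureTrue : Formula D → Set
  ExClosureTrue χ = Σ Env λ ρ → SatF ρ χ

module Submission where

-- Interpret program formulas directly in total environments σ : Var → D, and prove by one
-- simultaneous induction on the computation tree ⟦φ⟧_α: a success leaf α′ extends α, is
-- single-valued, and every σ agreeing with α′ satisfies φ; if the tree is failed, no σ
-- agreeing with α satisfies φ.  The two halves call each other at → and ¬, where the test
-- φ₁ is α-closed and hence decided by α alone; at ∃ the freshness of the renamed bound
-- variable y makes choosing a value for y harmless.  The closures are then read off
-- through  ρ ⊨ φ^α ⇔ (ρ overridden by α) ⊨ φ.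

open import Defs
open import Data.Empty using (⊥)
open import Data.Maybe using (just; nothing; fromMaybe)
open import Data.Nat using (_≟_)
open import Data.Product using (_×_; _,_; Σ; ∃; proj₁)
open import Data.Product.Function.Dependent.Propositional using (congˡ)
open import Data.Product.Function.NonDependent.Propositional using (_×-⇔_)
open import Data.Sum using (_⊎_; inj₁; inj₂; [_,_]; map₂)
open import Data.Sum.Function.Propositional using (_⊎-⇔_)
open import Data.Unit using (⊤; tt)
open import Data.Vec using (Vec; []; _∷_)
open import Data.Vec.Relation.Unary.Any as VAny using ()
open import Data.List using ([]; _∷_; _++_)
open import Data.List.Properties using (filter-accept; filter-reject)
open import Data.List.Relation.Unary.Any using (here; there)
open import Data.List.Relation.Unary.All using (_∷_)
open import Data.List.Membership.Propositional using (_∈_)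
open import Function using (_∘_; id; _⇔_; mk⇔; Equivalence)
open import Function.Construct.Composition using (_⇔-∘_)
open import Function.Construct.Identity using (⇔-id)
open import Function.Construct.Symmetry using (⇔-sym)
open import Function.Related.TypeIsomorphisms using (→-cong-⇔; ¬-cong-⇔)
open import Relation.Nullary using (¬_; yes; no; ¬?; contradiction)
open import Relation.Binary.PropositionalEquality hiding ([_])

module Soundness (S : Signature) (I : Interpretation S) where
  open Signature S
  open Interpretation I
  open Semantics S I
  open Equivalence using (to; from)

  mutual
    value : Env → Term ⊥ → D
    value σ (var x)    = σ x
    value σ (nm ())
    value σ (fun f ts) = funI f (values σ ts)

    values : ∀ {n} → Env → Vec (Term ⊥) n → Vec D n
    values σ []       = []
    values σ (t ∷ ts) = value σ t ∷ values σ ts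

  infix 4 _⊨ᵃ_ _⊨ᶜ_ _⊨_

  _⊨ᵃ_ : Env → Atom ⊥ → Set
  σ ⊨ᵃ s ≐ t    = value σ s ≡ value σ t
  σ ⊨ᵃ rel R ts = relI R (values σ ts)

  mutual
    _⊨ᶜ_ : Env → Conj ⊥ → Set
    σ ⊨ᶜ atom A    = σ ⊨ᵃ A
    σ ⊨ᶜ or φ₁ φ₂  = σ ⊨ φ₁ ⊎ σ ⊨ φ₂
    σ ⊨ᶜ and φ₁ φ₂ = σ ⊨ φ₁ × σ ⊨ φ₂
    σ ⊨ᶜ imp φ₁ φ₂ = σ ⊨ φ₁ → σ ⊨ φ₂
    σ ⊨ᶜ neg φ     = ¬ σ ⊨ φ
    σ ⊨ᶜ ex x φ    = Σ D λ d → σ [ x ↦ d ] ⊨ φ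

    _⊨_ : Env → Formula ⊥ → Set
    σ ⊨ []      = ⊤
    σ ⊨ (c ∷ φ) = σ ⊨ᶜ c × σ ⊨ φ

  ⊨-++ : ∀ {σ} φ {ψ} → σ ⊨ φ ++ ψ ⇔ (σ ⊨ φ × σ ⊨ ψ)
  ⊨-++ []      = mk⇔ (tt ,_) (λ (_ , s) → s)
  ⊨-++ (c ∷ φ) = mk⇔ (λ (a , s) → let p , q = to (⊨-++ φ) s in (a , p) , q)
                     (λ ((a , p) , q) → a , from (⊨-++ φ) (p , q))

  update-≡ : ∀ σ x d → (σ [ x ↦ d ]) x ≡ d
  update-≡ σ x d with x ≟ x
  ... | yes _  = refl
  ... | no x≢x = contradiction refl x≢x

  update-≢ : ∀ σ x d {z} → z ≢ x → (σ [ x ↦ d ]) z ≡ σ z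
  update-≢ σ x d {z} z≢x with z ≟ x
  ... | yes z≡x = contradiction z≡x z≢x
  ... | no _    = refl

  update-cong : ∀ {ρ σ} x d {z} → (z ≢ x → ρ z ≡ σ z) → (ρ [ x ↦ d ]) z ≡ (σ [ x ↦ d ]) z
  update-cong x d {z} h with z ≟ x
  ... | yes _  = refl
  ... | no z≢x = h z≢x

  update-overwrite : ∀ σ x e d → (σ [ x ↦ e ]) [ x ↦ d ] ≗ σ [ x ↦ d ]
  update-overwrite σ x e d z = update-cong {σ [ x ↦ e ]} x d {z} (update-≢ σ x e)

  update-comm : ∀ σ {x z} d e → x ≢ z → (σ [ z ↦ d ]) [ x ↦ e ] ≗ (σ [ x ↦ e ]) [ z ↦ d ]
  update-comm σ {x} {z} d e x≢z w with w ≟ x | w ≟ z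
  ... | yes refl | yes refl = contradiction refl x≢z
  ... | yes refl | no _     = sym (update-≡ σ x e)
  ... | no _     | yes refl = update-≡ σ z d
  ... | no w≢x   | no w≢z   = trans (update-≢ σ z d w≢z) (sym (update-≢ σ x e w≢x))

  mutual
    value-cong : ∀ {ρ σ} t → (∀ x → OccT x t → ρ x ≡ σ x) → value ρ t ≡ value σ t
    value-cong (var x)    h = h x here
    value-cong (nm ())
    value-cong (fun f ts) h = cong (funI f) (values-cong ts (λ x → h x ∘ inFun))

    values-cong : ∀ {ρ σ n} (ts : Vec (Term ⊥) n) →
                  (∀ x → VAny.Any (OccT x) ts → ρ x ≡ σ x) → values ρ ts ≡ values σ ts
    values-cong []       h = refl
    values-cong (t ∷ ts) h = cong₂ _∷_ (value-cong t (λ x → h x ∘ VAny.here))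
                                       (values-cong ts (λ x → h x ∘ VAny.there))

  ⊨ᵃ-cong : ∀ {ρ σ} A → (∀ x → OccA x A → ρ x ≡ σ x) → ρ ⊨ᵃ A ⇔ σ ⊨ᵃ A
  ⊨ᵃ-cong (s ≐ t) h
    rewrite value-cong s (λ x → h x ∘ inEq₁) | value-cong t (λ x → h x ∘ inEq₂) = ⇔-id _
  ⊨ᵃ-cong (rel R ts) h rewrite values-cong ts (λ x → h x ∘ inRel) = ⇔-id _

  mutual
    ⊨ᶜ-cong : ∀ {ρ σ} c → (∀ x → FreeC x c → ρ x ≡ σ x) → ρ ⊨ᶜ c ⇔ σ ⊨ᶜ c
    ⊨ᶜ-cong (atom A)    h = ⊨ᵃ-cong A (λ x → h x ∘ fAtom)
    ⊨ᶜ-cong (or φ₁ φ₂)  h = ⊨-cong φ₁ (λ x → h x ∘ fOr₁) ⊎-⇔ ⊨-cong φ₂ (λ x → h x ∘ fOr₂)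
    ⊨ᶜ-cong (and φ₁ φ₂) h = ⊨-cong φ₁ (λ x → h x ∘ fAnd₁) ×-⇔ ⊨-cong φ₂ (λ x → h x ∘ fAnd₂)
    ⊨ᶜ-cong (imp φ₁ φ₂) h = →-cong-⇔ (⊨-cong φ₁ (λ x → h x ∘ fImp₁)) (⊨-cong φ₂ (λ x → h x ∘ fImp₂))
    ⊨ᶜ-cong (neg φ)     h = ¬-cong-⇔ (⊨-cong φ (λ x → h x ∘ fNeg))
    ⊨ᶜ-cong (ex y φ)    h = congˡ (⊨-cong φ (λ x o → update-cong y _ (λ x≢y → h x (fEx x≢y o))))

    ⊨-cong : ∀ {ρ σ} φ → (∀ x → FreeF x φ → ρ x ≡ σ x) → ρ ⊨ φ ⇔ σ ⊨ φ
    ⊨-cong []      h = ⇔-id _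
    ⊨-cong (c ∷ φ) h = ⊨ᶜ-cong c (λ x → h x ∘ here) ×-⇔ ⊨-cong φ (λ x → h x ∘ there)

  ⊨-cong-≗ : ∀ {ρ σ} φ → ρ ≗ σ → ρ ⊨ φ ⇔ σ ⊨ φ
  ⊨-cong-≗ φ ρ≗σ = ⊨-cong φ (λ x _ → ρ≗σ x)

  Agrees : Env → Valuation → Set
  Agrees σ α = ∀ {x d} → (x , d) ∈ α → σ x ≡ d

  LookupAgrees : Env → Valuation → Set
  LookupAgrees σ α = ∀ {x d} → lookupV α x ≡ just d → σ x ≡ d

  lookupV-∈ : ∀ α {x d} → lookupV α x ≡ just d → (x , d) ∈ α
  lookupV-∈ ((y , e) ∷ α) {x} eq with x ≟ y
  lookupV-∈ ((y , e) ∷ α) refl | yes refl = here refl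
  ... | no _ = there (lookupV-∈ α eq)

  lookupV-dom : ∀ α {x} → x ∈dom α → ∃ λ d → lookupV α x ≡ just d
  lookupV-dom ((y , e) ∷ α) {x} (d , x∈α) with x ≟ y | x∈α
  ... | yes _  | _            = e , refl
  ... | no x≢y | here refl    = contradiction refl x≢y
  ... | no _   | there x∈α′   = lookupV-dom α (d , x∈α′)

  agrees⇒lookupAgrees : ∀ {σ} α → Agrees σ α → LookupAgrees σ α
  agrees⇒lookupAgrees α ag = ag ∘ lookupV-∈ α

  _⊕_ : Env → Valuation → Env
  (ρ ⊕ α) x = fromMaybe (ρ x) (lookupV α x)

  ⊕-lookupAgrees : ∀ ρ α → LookupAgrees (ρ ⊕ α) α
  ⊕-lookupAgrees ρ α eq rewrite eq = refl

  ⊕-agrees : ∀ ρ {α} → SingleValued α → Agrees (ρ ⊕ α) α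
  ⊕-agrees ρ {α} sv {x} x∈α with lookupV-dom α (_ , x∈α)
  ... | e , eq rewrite eq = sv (lookupV-∈ α eq) x∈α

  ⊕-agrees-id : ∀ {σ} α → Agrees σ α → σ ⊕ α ≗ σ
  ⊕-agrees-id α ag x with lookupV α x in eq
  ... | just d  = sym (ag (lookupV-∈ α eq))
  ... | nothing = refl

  mutual
    evalT-sound : ∀ {σ α d} t → LookupAgrees σ α → evalT α t ≡ just d → value σ t ≡ d
    evalT-sound (var x) ag eq = ag eq
    evalT-sound (nm ())
    evalT-sound {α = α} (fun f ts) ag eq with evalTs α ts in eqs
    evalT-sound (fun f ts) ag refl | just ds = cong (funI f) (evalTs-sound ts ag eqs)

    evalTs-sound : ∀ {σ α n ds} (ts : Vec (Term ⊥) n) →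
                   LookupAgrees σ α → evalTs α ts ≡ just ds → values σ ts ≡ ds
    evalTs-sound []       ag refl = refl
    evalTs-sound {α = α} (t ∷ ts) ag eq with evalT α t in eq₁ | evalTs α ts in eq₂
    evalTs-sound (t ∷ ts) ag refl | just d | just ds =
      cong₂ _∷_ (evalT-sound t ag eq₁) (evalTs-sound ts ag eq₂)

  mutual
    evalT-closed : ∀ {σ α} t → Agrees σ α → ClosedT α t → evalT α t ≡ just (value σ t)
    evalT-closed {α = α} (var x) ag cl with lookupV-dom α (cl x here)
    ... | d , eq = trans eq (cong just (sym (ag (lookupV-∈ α eq))))
    evalT-closed (nm ())
    evalT-closed (fun f ts) ag cl rewrite evalTs-closed ts ag (λ x → cl x ∘ inFun) = refl

    evalTs-closed : ∀ {σ α n} (ts : Vec (Term ⊥) n) → Agrees σ α →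
                    (∀ x → VAny.Any (OccT x) ts → x ∈dom α) → evalTs α ts ≡ just (values σ ts)
    evalTs-closed []       ag cl = refl
    evalTs-closed (t ∷ ts) ag cl
      rewrite evalT-closed t ag (λ x → cl x ∘ VAny.here)
            | evalTs-closed ts ag (λ x → cl x ∘ VAny.there) = refl

  holdsA-sound : ∀ {σ α} A → Agrees σ α → HoldsA α A → σ ⊨ᵃ A
  holdsA-sound {α = α} (s ≐ t) ag (d , eqs , eqt) =
    trans (evalT-sound s ag′ eqs) (sym (evalT-sound t ag′ eqt))
    where ag′ = agrees⇒lookupAgrees α ag
  holdsA-sound {α = α} (rel R ts) ag (ds , eq , r) =
    subst (relI R) (sym (evalTs-sound ts (agrees⇒lookupAgrees α ag) eq)) r

  holdsA-complete : ∀ {σ α} A → Agrees σ α → ClosedA α A → σ ⊨ᵃ A → HoldsA α A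
  holdsA-complete {σ} (s ≐ t) ag cl s≡t =
    value σ s , evalT-closed s ag (λ x → cl x ∘ inEq₁) ,
    trans (evalT-closed t ag (λ x → cl x ∘ inEq₂)) (cong just (sym s≡t))
  holdsA-complete {σ} (rel R ts) ag cl r =
    values σ ts , evalTs-closed ts ag (λ x → cl x ∘ inRel) , r

  mutual
    ⟦substT⟧ : ∀ ρ α t → ⟦ substT α t ⟧T ρ ≡ value (ρ ⊕ α) t
    ⟦substT⟧ ρ α (var x) with lookupV α x
    ... | just d  = refl
    ... | nothing = refl
    ⟦substT⟧ ρ α (nm ())
    ⟦substT⟧ ρ α (fun f ts) with evalTs α ts in eq
    ... | just ds = cong (funI f) (sym (evalTs-sound ts (⊕-lookupAgrees ρ α) eq))
    ... | nothing = cong (funI f) (⟦substTs⟧ ρ α ts)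

    ⟦substTs⟧ : ∀ ρ α {n} (ts : Vec (Term ⊥) n) → ⟦ substTs α ts ⟧Ts ρ ≡ values (ρ ⊕ α) ts
    ⟦substTs⟧ ρ α []       = refl
    ⟦substTs⟧ ρ α (t ∷ ts) = cong₂ _∷_ (⟦substT⟧ ρ α t) (⟦substTs⟧ ρ α ts)

  SatA-substA : ∀ ρ α A → SatA ρ (substA α A) ⇔ ρ ⊕ α ⊨ᵃ A
  SatA-substA ρ α (s ≐ t) rewrite ⟦substT⟧ ρ α s | ⟦substT⟧ ρ α t = ⇔-id _
  SatA-substA ρ α (rel R ts) rewrite ⟦substTs⟧ ρ α ts = ⇔-id _

  removeV-∷-≡ : ∀ x e α → removeV x ((x , e) ∷ α) ≡ removeV x α
  removeV-∷-≡ x e α = filter-reject (λ p → ¬? (proj₁ p ≟ x)) (λ x≢x → x≢x refl)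

  removeV-∷-≢ : ∀ x {y} e α → y ≢ x → removeV x ((y , e) ∷ α) ≡ (y , e) ∷ removeV x α
  removeV-∷-≢ x e α = filter-accept (λ p → ¬? (proj₁ p ≟ x))

  lookupV-removeV-≡ : ∀ x α → lookupV (removeV x α) x ≡ nothing
  lookupV-removeV-≡ x []            = refl
  lookupV-removeV-≡ x ((y , e) ∷ α) with y ≟ x
  ... | yes refl rewrite removeV-∷-≡ x e α = lookupV-removeV-≡ x α
  ... | no y≢x   rewrite removeV-∷-≢ x e α y≢x with x ≟ y
  ...   | yes x≡y = contradiction (sym x≡y) y≢x
  ...   | no _    = lookupV-removeV-≡ x α

  lookupV-removeV-≢ : ∀ x α {w} → w ≢ x → lookupV (removeV x α) w ≡ lookupV α w
  lookupV-removeV-≢ x []            w≢x = refl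
  lookupV-removeV-≢ x ((y , e) ∷ α) {w} w≢x with y ≟ x
  ... | yes refl rewrite removeV-∷-≡ x e α with w ≟ x
  ...   | yes w≡x = contradiction w≡x w≢x
  ...   | no _    = lookupV-removeV-≢ x α w≢x
  lookupV-removeV-≢ x ((y , e) ∷ α) {w} w≢x | no y≢x rewrite removeV-∷-≢ x e α y≢x with w ≟ y
  ...   | yes _ = refl
  ...   | no _  = lookupV-removeV-≢ x α w≢x

  ⊕-removeV : ∀ ρ α x d → (ρ [ x ↦ d ]) ⊕ removeV x α ≗ (ρ ⊕ α) [ x ↦ d ]
  ⊕-removeV ρ α x d w with w ≟ x
  ... | yes refl rewrite lookupV-removeV-≡ w α = refl
  ... | no w≢x   rewrite lookupV-removeV-≢ x α w≢x = refl

  mutual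
    SatC-substC : ∀ ρ α c → SatC ρ (substC α c) ⇔ ρ ⊕ α ⊨ᶜ c
    SatC-substC ρ α (atom A)    = SatA-substA ρ α A
    SatC-substC ρ α (or φ₁ φ₂)  = SatF-substF ρ α φ₁ ⊎-⇔ SatF-substF ρ α φ₂
    SatC-substC ρ α (and φ₁ φ₂) = SatF-substF ρ α φ₁ ×-⇔ SatF-substF ρ α φ₂
    SatC-substC ρ α (imp φ₁ φ₂) = →-cong-⇔ (SatF-substF ρ α φ₁) (SatF-substF ρ α φ₂)
    SatC-substC ρ α (neg φ)     = ¬-cong-⇔ (SatF-substF ρ α φ)
    SatC-substC ρ α (ex x φ)    =
      congˡ (λ {d} → ⊨-cong-≗ φ (⊕-removeV ρ α x d) ⇔-∘ SatF-substF (ρ [ x ↦ d ]) (removeV x α) φ)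

    SatF-substF : ∀ ρ α φ → SatF ρ (substF α φ) ⇔ ρ ⊕ α ⊨ φ
    SatF-substF ρ α []      = ⇔-id _
    SatF-substF ρ α (c ∷ φ) = SatC-substC ρ α c ×-⇔ SatF-substF ρ α φ

  mutual
    freeC⇒occC : ∀ {z} c → FreeC z c → OccC z c
    freeC⇒occC (atom A)    (fAtom o) = oAtom o
    freeC⇒occC (or φ₁ φ₂)  (fOr₁ o)  = oOr₁ (freeF⇒occF φ₁ o)
    freeC⇒occC (or φ₁ φ₂)  (fOr₂ o)  = oOr₂ (freeF⇒occF φ₂ o)
    freeC⇒occC (and φ₁ φ₂) (fAnd₁ o) = oAnd₁ (freeF⇒occF φ₁ o)
    freeC⇒occC (and φ₁ φ₂) (fAnd₂ o) = oAnd₂ (freeF⇒occF φ₂ o)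
    freeC⇒occC (imp φ₁ φ₂) (fImp₁ o) = oImp₁ (freeF⇒occF φ₁ o)
    freeC⇒occC (imp φ₁ φ₂) (fImp₂ o) = oImp₂ (freeF⇒occF φ₂ o)
    freeC⇒occC (neg φ)     (fNeg o)  = oNeg (freeF⇒occF φ o)
    freeC⇒occC (ex y φ)    (fEx _ o) = oEx (freeF⇒occF φ o)

    freeF⇒occF : ∀ {z} (φ : Formula ⊥) → FreeF z φ → OccF z φ
    freeF⇒occF (c ∷ φ) (here o)  = here (freeC⇒occC c o)
    freeF⇒occF (c ∷ φ) (there o) = there (freeF⇒occF φ o)

  mutual
    value-renT : ∀ x y σ t → value σ (renT x y t) ≡ value (σ [ x ↦ σ y ]) t
    value-renT x y σ (var z) with z ≟ x
    ... | yes _ = refl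
    ... | no _  = refl
    value-renT x y σ (nm ())
    value-renT x y σ (fun f ts) = cong (funI f) (values-renTs x y σ ts)

    values-renTs : ∀ x y σ {n} (ts : Vec (Term ⊥) n) →
                   values σ (renTs x y ts) ≡ values (σ [ x ↦ σ y ]) ts
    values-renTs x y σ []       = refl
    values-renTs x y σ (t ∷ ts) = cong₂ _∷_ (value-renT x y σ t) (values-renTs x y σ ts)

  ⊨ᵃ-renA : ∀ x y σ A → σ ⊨ᵃ renA x y A ⇔ σ [ x ↦ σ y ] ⊨ᵃ A
  ⊨ᵃ-renA x y σ (s ≐ t) rewrite value-renT x y σ s | value-renT x y σ t = ⇔-id _
  ⊨ᵃ-renA x y σ (rel R ts) rewrite values-renTs x y σ ts = ⇔-id _

  SafeRenaming : Var → Var → Formula ⊥ → Set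
  SafeRenaming x y φ = y ≡ x ⊎ ¬ OccF y φ

  mutual
    ⊨ᶜ-renC : ∀ x y σ c → y ≡ x ⊎ ¬ OccC y c → σ ⊨ᶜ renC x y c ⇔ σ [ x ↦ σ y ] ⊨ᶜ c
    ⊨ᶜ-renC x y σ (atom A) _ = ⊨ᵃ-renA x y σ A
    ⊨ᶜ-renC x y σ (or φ₁ φ₂) safe =
      ⊨-renF x y σ φ₁ (map₂ (_∘ oOr₁) safe) ⊎-⇔ ⊨-renF x y σ φ₂ (map₂ (_∘ oOr₂) safe)
    ⊨ᶜ-renC x y σ (and φ₁ φ₂) safe =
      ⊨-renF x y σ φ₁ (map₂ (_∘ oAnd₁) safe) ×-⇔ ⊨-renF x y σ φ₂ (map₂ (_∘ oAnd₂) safe)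
    ⊨ᶜ-renC x y σ (imp φ₁ φ₂) safe =
      →-cong-⇔ (⊨-renF x y σ φ₁ (map₂ (_∘ oImp₁) safe)) (⊨-renF x y σ φ₂ (map₂ (_∘ oImp₂) safe))
    ⊨ᶜ-renC x y σ (neg φ) safe = ¬-cong-⇔ (⊨-renF x y σ φ (map₂ (_∘ oNeg) safe))
    ⊨ᶜ-renC x y σ (ex z φ) safe with z ≟ x
    ... | yes refl = congˡ (⇔-sym (⊨-cong-≗ φ (update-overwrite σ z (σ y) _)))
    ... | no z≢x   =
      congˡ (λ {d} → ⊨-cong-≗ φ (commute d) ⇔-∘ ⊨-renF x y (σ [ z ↦ d ]) φ (map₂ (_∘ oEx) safe))
      where
      y≢z : y ≢ z
      y≢z refl = [ z≢x , (λ y∉ex → y∉ex oBind) ] safe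
      commute : ∀ d → (σ [ z ↦ d ]) [ x ↦ (σ [ z ↦ d ]) y ] ≗ (σ [ x ↦ σ y ]) [ z ↦ d ]
      commute d rewrite update-≢ σ z d y≢z = update-comm σ d (σ y) (z≢x ∘ sym)

    ⊨-renF : ∀ x y σ φ → SafeRenaming x y φ → σ ⊨ renF x y φ ⇔ σ [ x ↦ σ y ] ⊨ φ
    ⊨-renF x y σ []      _    = ⇔-id _
    ⊨-renF x y σ (c ∷ φ) safe =
      ⊨ᶜ-renC x y σ c (map₂ (_∘ here) safe) ×-⇔ ⊨-renF x y σ φ (map₂ (_∘ there) safe)

  agrees-update-fresh : ∀ {σ α y} d → ¬ y ∈dom α → Agrees σ α → Agrees (σ [ y ↦ d ]) α
  agrees-update-fresh {σ} {y = y} d y∉α ag {x} x∈α =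
    trans (update-≢ σ y d (λ { refl → y∉α (_ , x∈α) })) (ag x∈α)

  singleValued-∷ : ∀ {α x d} → SingleValued α → ¬ x ∈dom α → SingleValued ((x , d) ∷ α)
  singleValued-∷ sv x∉α (here refl) (here refl) = refl
  singleValued-∷ sv x∉α (here refl) (there m)   = contradiction (_ , m) x∉α
  singleValued-∷ sv x∉α (there m)   (here refl) = contradiction (_ , m) x∉α
  singleValued-∷ sv x∉α (there m)   (there m′)  = sv m m′

  assignment-fresh : ∀ {α A x d} → Assignment α A x d → ¬ x ∈dom α
  assignment-fresh (asgL x∉α _ _) = x∉α
  assignment-fresh (asgR x∉α _ _) = x∉α

  assignment-⇔ : ∀ {σ α A x d} → Assignment α A x d → Agrees σ α → σ ⊨ᵃ A ⇔ σ x ≡ d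
  assignment-⇔ {α = α} (asgL {t = t} _ _ eq) ag
    rewrite evalT-sound t (agrees⇒lookupAgrees α ag) eq = ⇔-id _
  assignment-⇔ {α = α} (asgR {t = t} _ _ eq) ag
    rewrite evalT-sound t (agrees⇒lookupAgrees α ag) eq = mk⇔ sym sym

  success-child : ∀ {α′ φ β T} → SuccessLeaf α′ (node φ β (T ∷ [])) → SuccessLeaf α′ T
  success-child (below (here l)) = l

  failed-child : ∀ {φ β T} → Failed (node φ β (T ∷ [])) → Failed T
  failed-child (node (f ∷ _)) = f

  -- Single-valuedness of α′ is part of the invariant because only then does every
  -- environment overridden by α′ agree with α′ (⊕-agrees).
  record Answer (φ : Formula ⊥) (α α′ : Valuation) : Set where
    field
      grows         : α′ extends α
      single-valued : SingleValued α′
      satisfies     : ∀ σ → Agrees σ α′ → σ ⊨ φ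

  open Answer

  answer-map : ∀ {φ ψ α α′} → (∀ σ → Agrees σ α → σ ⊨ ψ → σ ⊨ φ) → Answer ψ α α′ → Answer φ α α′
  answer-map ψ⇒φ a = record
    { grows         = grows a
    ; single-valued = single-valued a
    ; satisfies     = λ σ ag → ψ⇒φ σ (ag ∘ grows a) (satisfies a σ ag)
    }

  closed-answer : ∀ {φ α α′} → ClosedF α φ → Answer φ α α′ → ∀ σ → Agrees σ α → σ ⊨ φ
  closed-answer {φ} {α′ = α′} cl a σ ag =
    to (⊨-cong φ agree) (satisfies a (σ ⊕ α′) (⊕-agrees σ (single-valued a)))
    where
    agree : ∀ x → FreeF x φ → (σ ⊕ α′) x ≡ σ x
    agree x o = let _ , x∈α = cl x o in
      trans (⊕-agrees σ (single-valued a) (grows a x∈α)) (sym (ag x∈α))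

  ⊨-renF⇒⊨-ex : ∀ {x y φ σ} → SafeRenaming x y φ → σ ⊨ renF x y φ → σ ⊨ᶜ ex x φ
  ⊨-renF⇒⊨-ex {x} {y} {φ} {σ} safe s = σ y , to (⊨-renF x y σ φ safe) s

  ⊨-ex⇒⊨-renF : ∀ {x y φ ψ σ} → SafeRenaming x y φ → ¬ FreeF y ψ →
                σ ⊨ ex x φ ∷ ψ → ∃ λ d → σ [ y ↦ d ] ⊨ renF x y φ ++ ψ
  ⊨-ex⇒⊨-renF {x} {y} {φ} {ψ} {σ} safe y∉ψ ((d , sφ) , sψ) =
    d , from (⊨-++ (renF x y φ)) (from (⊨-renF x y τ φ safe) (to (⊨-cong φ agreeφ) sφ) ,
                                  to (⊨-cong ψ agreeψ) sψ)
    where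
    τ = σ [ y ↦ d ]
    agreeψ : ∀ z → FreeF z ψ → σ z ≡ τ z
    agreeψ z z∈ψ = sym (update-≢ σ y d (λ { refl → y∉ψ z∈ψ }))
    agreeφ : ∀ z → FreeF z φ → (σ [ x ↦ d ]) z ≡ (τ [ x ↦ τ y ]) z
    agreeφ z z∈φ rewrite update-≡ σ y d = update-cong x d z≢x⇒σz≡τz
      where
      z≢x⇒σz≡τz : z ≢ x → σ z ≡ τ z
      z≢x⇒σz≡τz z≢x =
        sym (update-≢ σ y d (λ { refl → [ z≢x , (λ z∉φ → z∉φ (freeF⇒occF φ z∈φ)) ] safe }))

  mutual
    success-sound : ∀ {φ α α′ T} → Comp φ α T → SingleValued α → SuccessLeaf α′ T → Answer φ α α′
    success-sound c-□ sv (below (here leaf)) =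
      record { grows = id ; single-valued = sv ; satisfies = λ _ _ → tt }
    success-sound (c-true {A} _ holds c) sv l =
      answer-map (λ σ ag s → holdsA-sound A ag holds , s) (success-sound c sv (success-child l))
    success-sound (c-false _ _) sv l with success-child l
    ... | ()
    success-sound (c-aerr _ _) sv l with success-child l
    ... | ()
    success-sound (c-assign asg c) sv l =
      let a = success-sound c (singleValued-∷ sv (assignment-fresh asg)) (success-child l) in
      record
        { grows         = grows a ∘ there
        ; single-valued = single-valued a
        ; satisfies     = λ σ ag →
            from (assignment-⇔ asg (ag ∘ grows a ∘ there)) (ag (grows a (here refl))) ,
            satisfies a σ ag
        }
    success-sound (c-or {φ₁} {φ₂} c₁ c₂) sv (below (here l)) =
      answer-map (λ σ _ s → let p , q = to (⊨-++ φ₁) s in inj₁ p , q) (success-sound c₁ sv l)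
    success-sound (c-or {φ₁} {φ₂} c₁ c₂) sv (below (there (here l))) =
      answer-map (λ σ _ s → let p , q = to (⊨-++ φ₂) s in inj₂ p , q) (success-sound c₂ sv l)
    success-sound (c-and {φ₁} {φ₂} c) sv l =
      answer-map (λ σ _ s → let p , qr = to (⊨-++ φ₁) s ; q , r = to (⊨-++ φ₂) qr in (p , q) , r)
                 (success-sound c sv (success-child l))
    success-sound (c-impF _ c₁ failed₁ c) sv l =
      answer-map (λ σ ag s → (λ p → contradiction p (failure-sound c₁ sv failed₁ σ ag)) , s)
                 (success-sound c sv (success-child l))
    success-sound (c-impS {φ₁} {φ₂} _ _ _ c) sv l =
      answer-map (λ σ _ s → let p , q = to (⊨-++ φ₂) s in (λ _ → p) , q)
                 (success-sound c sv (success-child l))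
    success-sound (c-impE _) sv l with success-child l
    ... | ()
    success-sound (c-negF _ c₁ failed₁ c) sv l =
      answer-map (λ σ ag s → failure-sound c₁ sv failed₁ σ ag , s)
                 (success-sound c sv (success-child l))
    success-sound (c-negS _ _ _) sv l with success-child l
    ... | ()
    success-sound (c-negE _) sv l with success-child l
    ... | ()
    success-sound (c-ex {x} {φ} _ _ _ safe c) sv l =
      answer-map (λ σ _ s → let p , q = to (⊨-++ (renF x _ φ)) s in ⊨-renF⇒⊨-ex safe p , q)
                 (success-sound c sv (success-child l))

    failure-sound : ∀ {φ α T} → Comp φ α T → SingleValued α → Failed T →
                    ∀ σ → Agrees σ α → ¬ σ ⊨ φ
    failure-sound c-□ _ (node (() ∷ _))
    failure-sound (c-true _ _ c) sv f σ ag (_ , s) = failure-sound c sv (failed-child f) σ ag s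
    failure-sound (c-false {A} closed ¬holds) _ _ σ ag (a , _) =
      ¬holds (holdsA-complete A ag closed a)
    failure-sound (c-aerr _ _) _ (node (() ∷ _))
    failure-sound (c-assign asg c) sv f σ ag (a , s) =
      failure-sound c (singleValued-∷ sv (assignment-fresh asg)) (failed-child f) σ ag′ s
      where
      ag′ : Agrees σ (_ ∷ _)
      ag′ (here refl) = to (assignment-⇔ asg ag) a
      ag′ (there m)   = ag m
    failure-sound (c-or {φ₁} c₁ _) sv (node (f₁ ∷ _)) σ ag (inj₁ p , q) =
      failure-sound c₁ sv f₁ σ ag (from (⊨-++ φ₁) (p , q))
    failure-sound (c-or {φ₂ = φ₂} _ c₂) sv (node (_ ∷ f₂ ∷ _)) σ ag (inj₂ p , q) =
      failure-sound c₂ sv f₂ σ ag (from (⊨-++ φ₂) (p , q))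
    failure-sound (c-and {φ₁} {φ₂} c) sv f σ ag ((p , q) , r) =
      failure-sound c sv (failed-child f) σ ag (from (⊨-++ φ₁) (p , from (⊨-++ φ₂) (q , r)))
    failure-sound (c-impF _ _ _ c) sv f σ ag (_ , s) = failure-sound c sv (failed-child f) σ ag s
    failure-sound (c-impS {φ₂ = φ₂} closed c₁ (_ , l₁) c) sv f σ ag (p⇒q , s) =
      failure-sound c sv (failed-child f) σ ag
        (from (⊨-++ φ₂) (p⇒q (closed-answer closed (success-sound c₁ sv l₁) σ ag) , s))
    failure-sound (c-impE _) _ (node (() ∷ _))
    failure-sound (c-negF _ _ _ c) sv f σ ag (_ , s) = failure-sound c sv (failed-child f) σ ag s
    failure-sound (c-negS closed c₁ (_ , l₁)) sv _ σ ag (¬p , _) =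
      ¬p (closed-answer closed (success-sound c₁ sv l₁) σ ag)
    failure-sound (c-negE _) _ (node (() ∷ _))
    failure-sound (c-ex y y∉α y∉ψ safe c) sv f σ ag s =
      let d , s′ = ⊨-ex⇒⊨-renF safe y∉ψ s in
      failure-sound c sv (failed-child f) (σ [ y ↦ d ]) (agrees-update-fresh d y∉α ag) s′

  answer-univ : ∀ {φ α α′} → Answer φ α α′ → UnivClosureTrue (substF α′ φ)
  answer-univ {φ} {α′ = α′} a ρ =
    from (SatF-substF ρ α′ φ) (satisfies a (ρ ⊕ α′) (⊕-agrees ρ (single-valued a)))

  answer-ex : ∀ {φ α α′} → Answer φ α α′ → ExClosureTrue (substF α φ)
  answer-ex {φ} {α} {α′} a =
    ρ , from (SatF-substF ρ α φ)
             (from (⊨-cong-≗ φ (⊕-agrees-id α (ρ⊨α′ ∘ grows a))) (satisfies a ρ ρ⊨α′))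
    where
    ρ : Env
    ρ = (λ _ → inhabitant) ⊕ α′
    ρ⊨α′ : Agrees ρ α′
    ρ⊨α′ = ⊕-agrees _ (single-valued a)

  failed⇒¬ex : ∀ {φ α T} → Comp φ α T → SingleValued α → Failed T → ¬ ExClosureTrue (substF α φ)
  failed⇒¬ex {φ} {α} c sv f (ρ , s) =
    failure-sound c sv f (ρ ⊕ α) (⊕-agrees ρ sv) (to (SatF-substF ρ α φ) s)

theorem1 : (S : Signature) (I : Interpretation S) →
    let open Semantics S I in
    (φ : Formula ⊥) (α : Valuation) → SingleValued α →
    (T : Tree) → Comp φ α T →
    ((α' : Valuation) → SuccessLeaf α' T →
      (α' extends α) × UnivClosureTrue (substF α' φ) × ExClosureTrue (substF α φ))
    × (Failed T → ¬ ExClosureTrue (substF α φ))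
theorem1 S I φ α sv T c =
  (λ α′ l → let a = success-sound c sv l in grows a , answer-univ a , answer-ex a) ,
  failed⇒¬ex c sv
  where
  open Soundness S I
  open Answer
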